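{- Let $\mathcal{T}$ be a set of unrooted binary phylogenetic trees on $X$ and let $F$ be an unrooted agreement forest for $\mathcal{T}$ of size $k$. Then for every $T \in \mathcal{T}$, \[ \sum_{B \in F} \deg^T(B) \le 2k - 2. \]
   Context: An unrooted binary phylogenetic tree on a finite set $X$ is an undirected tree in which every internal vertex has degree 3 and whose leaves are bijectively labelled by $X$. For nonempty $B \subseteq X$, $T[B]$ is the minimal subtree of $T$ spanning $B$, and $T|B$ is obtained from $T[B]$ by suppressing degree-2 vertices; trees are equal if there is a leaf-label-preserving isomorphism. The degree $\deg^T(B)$ is the number of edges of $T$ with exactly one endpoint in $T[B]$. An unrooted agreement forest for $\mathcal{T}$ is a partition $F$ of $X$ into nonempty blocks such that $T|B = T'|B$ for every block $B$ and all $T,T' \in \mathcal{T}$, and for distinct blocks $B, B'$ the subtrees $T[B]$, $T[B']$ are vertex-disjoint in every $T \in \mathcal{T}$; its size is $|F|$. -}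

module Defs where

open import Data.Bool using (Bool; true; false; if_then_else_)
open import Data.Nat using (ℕ; zero; suc; _+_; _*_; _∸_; _≤_)
open import Data.Fin using (Fin)
open import Data.Nat.ListAction using (sum)
open import Data.List using (List; []; _∷_; _++_; length; map; allFin; tabulate; head; last)
open import Data.List.Membership.Propositional using (_∈_)
open import Data.List.Relation.Unary.All using (All)
open import Data.List.Relation.Unary.Linked using (Linked)
open import Data.List.Relation.Unary.Unique.Propositional using (Unique)
open import Data.Maybe using (just)
open import Data.Product using (Σ; _×_; _,_; proj₁; proj₂)
open import Data.Sum using (_⊎_)
open import Function.Bundles using (_⇔_)
open import Function.Definitions using (Injective)
open import Relation.Binary.PropositionalEquality using (_≡_; _≢_)
open import Relation.Nullary using (¬_)

IsCount : {A : Set} → (A → Set) → ℕ → Set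
IsCount {A} P c =
  Σ (List A) λ xs → Unique xs × (∀ a → (a ∈ xs) ⇔ P a) × length xs ≡ c

module Graph {n : ℕ} (adj : Fin n → Fin n → Bool) where

  Adj : Fin n → Fin n → Set
  Adj u v = adj u v ≡ true

  deg : Fin n → ℕ
  deg v = sum (map (λ w → if adj v w then 1 else 0) (allFin n))

  IsPath : Fin n → Fin n → List (Fin n) → Set
  IsPath a b ps = Linked Adj ps × Unique ps × head ps ≡ just a × last ps ≡ just b

  Connected : Set
  Connected = ∀ u v → Σ (List (Fin n)) λ ps → IsPath u v ps

  HasCycle : Set
  HasCycle = Σ (Fin n) λ v → Σ (List (Fin n)) λ vs →
    2 ≤ length vs × Unique (v ∷ vs) × Linked Adj (v ∷ vs ++ v ∷ [])

-- Unrooted binary phylogenetic trees on X = Fin m.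
-- Leaves are the vertices of degree ≤ 1; every other (internal) vertex
-- has degree 3; leaves are bijectively labelled by X via `leaf`.

record UTree (m : ℕ) : Set where
  field
    n      : ℕ
    adj    : Fin n → Fin n → Bool
  open Graph adj public
  field
    adj-sym    : ∀ u v → adj u v ≡ adj v u
    adj-irrefl : ∀ v → adj v v ≡ false
    connected  : Connected
    acyclic    : ¬ HasCycle
    binary     : ∀ v → deg v ≤ 1 ⊎ deg v ≡ 3
    leaf       : Fin m → Fin n
    leaf-inj   : Injective _≡_ _≡_ leaf
    leaf-deg   : ∀ x → deg (leaf x) ≤ 1
    leaf-onto  : ∀ v → deg v ≤ 1 → Σ (Fin m) λ x → leaf x ≡ v

module _ {m : ℕ} (T : UTree m) where
  open UTree T

  -- vertex set of T[B] (B ⊆ X given as a predicate): all vertices lying on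
  -- a path of T between two leaves labelled by elements of B
  InSpan : (Fin m → Set) → Fin n → Set
  InSpan B v = Σ (Fin m) λ a → Σ (Fin m) λ b → B a × B b ×
    Σ (List (Fin n)) λ ps → IsPath (leaf a) (leaf b) ps × v ∈ ps

  -- deg^T(B) = d : exactly d edges of T have exactly one endpoint in T[B]
  -- (each such edge counted once, oriented from inside T[B] to outside)
  DegIs : (Fin m → Set) → ℕ → Set
  DegIs B d = IsCount {Fin n × Fin n}
    (λ p → Adj (proj₁ p) (proj₂ p) × InSpan B (proj₁ p) × ¬ InSpan B (proj₂ p)) d

  -- T|B: vertices of T[B] not of degree 2 in T[B] are kept ...
  Kept : (Fin m → Set) → Fin n → Set
  Kept B v = InSpan B v × ¬ IsCount (λ w → Adj v w × InSpan B w) 2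

  -- ... and two kept vertices are adjacent in T|B iff they are joined by a
  -- path of T[B] all of whose interior vertices are suppressed (degree 2)
  RAdj : (Fin m → Set) → Fin n → Fin n → Set
  RAdj B u v = Σ (List (Fin n)) λ mid →
    Linked Adj (u ∷ mid ++ v ∷ []) × Unique (u ∷ mid ++ v ∷ []) ×
    All (λ w → InSpan B w × ¬ Kept B w) mid

-- T|B = T'|B : a leaf-label-preserving isomorphism between the restrictions
RestrictEq : {m : ℕ} → UTree m → UTree m → (Fin m → Set) → Set
RestrictEq T T' B =
  Σ (Fin (UTree.n T) → Fin (UTree.n T')) λ φ →
  Σ (Fin (UTree.n T') → Fin (UTree.n T)) λ ψ →
    (∀ v → Kept T B v → Kept T' B (φ v)) ×
    (∀ v' → Kept T' B v' → Kept T B (ψ v')) ×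
    (∀ v → Kept T B v → ψ (φ v) ≡ v) ×
    (∀ v' → Kept T' B v' → φ (ψ v') ≡ v') ×
    (∀ u v → Kept T B u → Kept T B v → RAdj T B u v ⇔ RAdj T' B (φ u) (φ v)) ×
    (∀ x → B x → φ (UTree.leaf T x) ≡ UTree.leaf T' x)

-- A partition of X = Fin m into k nonempty blocks, given by the block
-- assignment blk : Fin m → Fin k (surjective, so every block is nonempty).

Block : {m k : ℕ} → (Fin m → Fin k) → Fin k → Fin m → Set
Block blk j x = blk x ≡ j

Surjective : {m k : ℕ} → (Fin m → Fin k) → Set
Surjective {m} blk = ∀ j → Σ (Fin m) λ x → blk x ≡ j

IsAgreementForest : {m k : ℕ} → List (UTree m) → (Fin m → Fin k) → Set
IsAgreementForest 𝒯 blk =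
  Surjective blk ×
  (∀ T T' → T ∈ 𝒯 → T' ∈ 𝒯 → ∀ j → RestrictEq T T' (Block blk j)) ×
  (∀ T → T ∈ 𝒯 → ∀ j j' → j ≢ j' → ∀ v →
     ¬ (InSpan T (Block blk j) v × InSpan T (Block blk j') v))

-- Let S₁, …, S_k be the vertex sets of the spans T[Bⱼ] of the blocks (disjoint, by the
-- forest property), and call a vertex free if it lies in none of them.  Every leaf lies in
-- the span of its own block, so free vertices have degree 3.  Count ordered pairs of
-- adjacent vertices: as T is acyclic the degree sum is at most 2(|V| − 1), and it splits
-- as Σⱼ (2 e(Sⱼ) + deg(Bⱼ)) + Σ_free deg.  Each Sⱼ is connected, so e(Sⱼ) ≥ |Sⱼ| − 1, and
-- |V| = Σⱼ |Sⱼ| + #free.  Together, Σⱼ deg(Bⱼ) ≤ 2k − 2 − (Σ_free deg − 2 · #free) ≤ 2k − 2.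

{-# OPTIONS --safe #-}
module Submission where

open import Defs
open import Data.Nat.Properties hiding (_≟_)
open import Algebra.Properties.Semiring.Sum +-*-semiring
  using (sum-cong-≗; sum-replicate-zero; ∑-distrib-+; ∑-comm; *-distribˡ-sum; *-distribʳ-sum)
  renaming (sum to ∑)
open import Data.Bool using (Bool; true; false; not; _∧_; _∨_; if_then_else_)
import Data.Bool.Properties as Bool
open import Data.Bool.Properties
  using (∧-conicalˡ; ∧-conicalʳ; ∧-identityʳ; ∧-zeroʳ; ∨-identityʳ; ∨-zeroʳ; ¬-not)
open import Data.Fin using (Fin; zero; suc; combine; remQuot; _↑ˡ_; _↑ʳ_)
open import Data.Fin.Properties using (_≟_; any?; remQuot-combine; combine-injective)
import Data.Fin.Properties as Fin
open import Data.List using (List; []; _∷_; _++_; head; last; length; map; tabulate)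
open import Data.List.Properties using (length-map; map-tabulate)
open import Data.List.Membership.Propositional using (_∈_)
open import Data.List.Relation.Binary.Subset.Propositional renaming (_⊆_ to _⊆ᴸ_)
open import Data.List.Relation.Unary.All as All using (All; []; _∷_)
import Data.List.Relation.Unary.All.Properties as All
open import Data.List.Relation.Unary.AllPairs using ([]; _∷_)
open import Data.List.Relation.Unary.Any using (here; there)
open import Data.List.Relation.Unary.Linked using (Linked; []; [-]; _∷_)
open import Data.List.Relation.Unary.Unique.Propositional using (Unique)
import Data.List.Relation.Unary.Unique.Propositional.Properties as Unique
open import Data.Maybe using (just)
open import Data.Maybe.Properties using (just-injective)
open import Data.Nat using (ℕ; zero; suc; _+_; _*_; _∸_; _≤_; _<_; _≤?_; _≡ᵇ_; z≤n; s≤s)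
open import Data.Nat.ListAction using (sum)
open import Data.Nat.Tactic.RingSolver using (solve-∀)
open import Data.Product using (∃; ∃₂; _×_; _,_; proj₁; proj₂; uncurry)
open import Data.Sum using (_⊎_; inj₁; inj₂)
open import Function using (_∘_; id; const)
open import Function.Bundles using (Equivalence)
open import Relation.Binary.PropositionalEquality
open import Relation.Nullary using (¬_; ¬?; Dec; yes; no; does; contradiction; _×-dec_)
open import Relation.Nullary.Decidable
  using (dec-true; dec-false; decidable-stable; ¬¬-excluded-middle)

head∈ : ∀ {A : Set} {a : A} {xs} → head xs ≡ just a → a ∈ xs
head∈ {xs = _ ∷ _} refl = here refl

last∈ : ∀ {A : Set} {a : A} {xs} → last xs ≡ just a → a ∈ xs
last∈ {xs = _ ∷ []}    refl  = here refl
last∈ {xs = _ ∷ _ ∷ _} last≡ = there (last∈ last≡)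

∈-tail : ∀ {A : Set} {t a : A} {as} → t ≢ a → t ∈ a ∷ as → t ∈ as
∈-tail t≢a (here t≡a) = contradiction t≡a t≢a
∈-tail _   (there t∈) = t∈

𝟙 : Bool → ℕ
𝟙 b = if b then 1 else 0

𝟙-* : ∀ b m → 𝟙 b * m ≡ (if b then m else 0)
𝟙-* true  m = +-identityʳ m
𝟙-* false m = refl

sum-tabulate : ∀ {n} (f : Fin n → ℕ) → sum (tabulate f) ≡ ∑ f
sum-tabulate {zero}  f = refl
sum-tabulate {suc n} f = cong (f zero +_) (sum-tabulate (f ∘ suc))

∑-const : ∀ n c → ∑ {n} (const c) ≡ n * c
∑-const zero    c = refl
∑-const (suc n) c = cong (c +_) (∑-const n c)

∑-mono-≤ : ∀ {n} {f g : Fin n → ℕ} → (∀ i → f i ≤ g i) → ∑ f ≤ ∑ g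
∑-mono-≤ {zero}  f≤g = z≤n
∑-mono-≤ {suc n} f≤g = +-mono-≤ (f≤g zero) (∑-mono-≤ (f≤g ∘ suc))

∑-↑ : ∀ m {n} (f : Fin (m + n) → ℕ) → ∑ f ≡ ∑ (λ (i : Fin m) → f (i ↑ˡ n)) + ∑ (λ i → f (m ↑ʳ i))
∑-↑ zero    f = refl
∑-↑ (suc m) f = trans (cong (f zero +_) (∑-↑ m (f ∘ suc))) (sym (+-assoc (f zero) _ _))

∑-combine : ∀ m {n} (f : Fin (m * n) → ℕ) → ∑ f ≡ ∑ λ (i : Fin m) → ∑ λ (j : Fin n) → f (combine i j)
∑-combine zero        f = refl
∑-combine (suc m) {n} f =
  trans (∑-↑ n f) (cong (∑ (λ j → f (j ↑ˡ m * n)) +_) (∑-combine m (λ i → f (n ↑ʳ i))))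

private variable n : ℕ

∑⟨_⟩_ : (Fin n → Bool) → (Fin n → ℕ) → ℕ
∑⟨ U ⟩ h = ∑ λ x → if U x then h x else 0

∣_∣ : (Fin n → Bool) → ℕ
∣ U ∣ = ∑⟨ U ⟩ const 1

⁅_⁆ : Fin n → Fin n → Bool
⁅ u ⁆ x = does (x ≟ u)

∁ : (Fin n → Bool) → Fin n → Bool
∁ U x = not (U x)

_─_ : (Fin n → Bool) → Fin n → Fin n → Bool
(U ─ u) x = U x ∧ not (does (x ≟ u))

_∪⁅_⁆ : (Fin n → Bool) → Fin n → Fin n → Bool
(U ∪⁅ u ⁆) x = U x ∨ does (x ≟ u)

_∖_ : (Fin n → Bool) → (Fin n → Bool) → Fin n → Bool
(U ∖ V) x = U x ∧ not (V x)

_⊆_ : (Fin n → Bool) → (Fin n → Bool) → Set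
U ⊆ V = ∀ x → U x ≡ true → V x ≡ true

_≐_⊕_ : (Fin n → Bool) → (Fin n → Bool) → Fin n → Set
U ≐ V ⊕ u = U u ≡ true × V u ≡ false × (∀ x → x ≢ u → U x ≡ V x)

∑⟨⟩-cong : {U V : Fin n → Bool} {f g : Fin n → ℕ} →
           (∀ x → U x ≡ V x) → (∀ x → f x ≡ g x) → ∑⟨ U ⟩ f ≡ ∑⟨ V ⟩ g
∑⟨⟩-cong {U = U} {V} {f} {g} U≗V f≗g =
  sum-cong-≗ {x = λ x → if U x then f x else 0} {y = λ x → if V x then g x else 0}
    λ x → cong₂ (λ b m → if b then m else 0) (U≗V x) (f≗g x)

∑⟨⟩-congʳ : ∀ (U : Fin n → Bool) {f g} → (∀ x → f x ≡ g x) → ∑⟨ U ⟩ f ≡ ∑⟨ U ⟩ g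
∑⟨⟩-congʳ U = ∑⟨⟩-cong {U = U} λ _ → refl

∑⟨⟩-empty : ∀ {n} {U : Fin n → Bool} h → (∀ x → U x ≡ false) → ∑⟨ U ⟩ h ≡ 0
∑⟨⟩-empty {n} {U} h U≗∅ = trans (sum-cong-≗ pointwise) (sum-replicate-zero n)
  where
  pointwise : ∀ x → (if U x then h x else 0) ≡ 0
  pointwise x rewrite U≗∅ x = refl

∑⟨⟩-distrib-+ : ∀ (U : Fin n → Bool) f g → ∑⟨ U ⟩ (λ x → f x + g x) ≡ ∑⟨ U ⟩ f + ∑⟨ U ⟩ g
∑⟨⟩-distrib-+ U f g =
  trans (sum-cong-≗ pointwise) (∑-distrib-+ (λ x → if U x then f x else 0) (λ x → if U x then g x else 0))
  where
  pointwise : ∀ x → (if U x then f x + g x else 0) ≡ (if U x then f x else 0) + (if U x then g x else 0)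
  pointwise x with U x
  ... | true  = refl
  ... | false = refl

∑⟨⟩-mono-≤ : ∀ (U : Fin n → Bool) {f g} → (∀ x → U x ≡ true → f x ≤ g x) → ∑⟨ U ⟩ f ≤ ∑⟨ U ⟩ g
∑⟨⟩-mono-≤ U {f} {g} f≤g = ∑-mono-≤ pointwise
  where
  pointwise : ∀ x → (if U x then f x else 0) ≤ (if U x then g x else 0)
  pointwise x with U x in Ux
  ... | true  = f≤g x Ux
  ... | false = z≤n

∑⟨⟩-+-∁ : ∀ (U : Fin n → Bool) h → ∑⟨ U ⟩ h + ∑⟨ ∁ U ⟩ h ≡ ∑ h
∑⟨⟩-+-∁ U h =
  trans (sym (∑-distrib-+ (λ x → if U x then h x else 0) (λ x → if not (U x) then h x else 0)))
        (sum-cong-≗ pointwise)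
  where
  pointwise : ∀ x → (if U x then h x else 0) + (if not (U x) then h x else 0) ≡ h x
  pointwise x with U x
  ... | true  = +-identityʳ (h x)
  ... | false = refl

∑⟨⟩-𝟙 : ∀ (U b : Fin n → Bool) → ∑⟨ U ⟩ (𝟙 ∘ b) ≡ ∣ (λ x → U x ∧ b x) ∣
∑⟨⟩-𝟙 U b = sum-cong-≗ pointwise
  where
  pointwise : ∀ x → (if U x then 𝟙 (b x) else 0) ≡ 𝟙 (U x ∧ b x)
  pointwise x with U x
  ... | true  = refl
  ... | false = refl

∑-partition : ∀ {k} (S : Fin k → Fin n → Bool) (F : Fin n → Bool) →
              (∀ x → ∣ (λ j → S j x) ∣ + 𝟙 (F x) ≡ 1) →
              ∀ h → ∑ h ≡ ∑ (λ j → ∑⟨ S j ⟩ h) + ∑⟨ F ⟩ h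
∑-partition S F covered-once h = begin
  ∑ h                                                       ≡⟨ sum-cong-≗ pointwise ⟨
  ∑ (λ x → ∑ (λ j → if S j x then h x else 0) + (if F x then h x else 0))
    ≡⟨ ∑-distrib-+ (λ x → ∑ (λ j → if S j x then h x else 0)) (λ x → if F x then h x else 0) ⟩
  ∑ (λ x → ∑ (λ j → if S j x then h x else 0)) + ∑⟨ F ⟩ h
    ≡⟨ cong (_+ ∑⟨ F ⟩ h) (∑-comm (λ x j → if S j x then h x else 0)) ⟩
  ∑ (λ j → ∑⟨ S j ⟩ h) + ∑⟨ F ⟩ h                           ∎
  where
  open ≡-Reasoning
  pointwise : ∀ x → ∑ (λ j → if S j x then h x else 0) + (if F x then h x else 0) ≡ h x
  pointwise x = begin
    ∑ (λ j → if S j x then h x else 0) + (if F x then h x else 0)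
      ≡⟨ cong₂ _+_ (sum-cong-≗ λ j → 𝟙-* (S j x) (h x)) (𝟙-* (F x) (h x)) ⟨
    ∑ (λ j → 𝟙 (S j x) * h x) + 𝟙 (F x) * h x
      ≡⟨ cong (_+ 𝟙 (F x) * h x) (*-distribʳ-sum (h x) λ j → 𝟙 (S j x)) ⟨
    ∣ (λ j → S j x) ∣ * h x + 𝟙 (F x) * h x     ≡⟨ *-distribʳ-+ (h x) ∣ (λ j → S j x) ∣ (𝟙 (F x)) ⟨
    (∣ (λ j → S j x) ∣ + 𝟙 (F x)) * h x         ≡⟨ cong (_* h x) (covered-once x) ⟩
    1 * h x                                     ≡⟨ *-identityˡ (h x) ⟩
    h x                                         ∎

∑⟨⁅⁆⟩ : ∀ {n} (u : Fin n) h → ∑⟨ ⁅ u ⁆ ⟩ h ≡ h u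
∑⟨⁅⁆⟩ {n = suc n} zero    h = trans (cong (h zero +_) (sum-replicate-zero n)) (+-identityʳ (h zero))
∑⟨⁅⁆⟩ {n = suc n} (suc u) h = ∑⟨⁅⁆⟩ u (h ∘ suc)

∑⟨⟩-⊕ : ∀ {U V : Fin n → Bool} {u} h → U ≐ V ⊕ u → ∑⟨ U ⟩ h ≡ h u + ∑⟨ V ⟩ h
∑⟨⟩-⊕ {U = U} {V} {u} h (Uu , Vu , U≗V) = begin
  ∑⟨ U ⟩ h                                                          ≡⟨ sum-cong-≗ pointwise ⟩
  ∑ (λ x → (if does (x ≟ u) then h x else 0) + (if V x then h x else 0))
    ≡⟨ ∑-distrib-+ (λ x → if does (x ≟ u) then h x else 0) (λ x → if V x then h x else 0) ⟩
  ∑⟨ ⁅ u ⁆ ⟩ h + ∑⟨ V ⟩ h                                           ≡⟨ cong (_+ ∑⟨ V ⟩ h) (∑⟨⁅⁆⟩ u h) ⟩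
  h u + ∑⟨ V ⟩ h                                                    ∎
  where
  open ≡-Reasoning
  pointwise : ∀ x → (if U x then h x else 0) ≡ (if does (x ≟ u) then h x else 0) + (if V x then h x else 0)
  pointwise x with x ≟ u
  ... | yes refl rewrite Uu | Vu = sym (+-identityʳ (h x))
  ... | no x≢u   rewrite U≗V x x≢u = refl

∣∣-⊕ : ∀ {U V : Fin n → Bool} {u} → U ≐ V ⊕ u → ∣ U ∣ ≡ suc ∣ V ∣
∣∣-⊕ = ∑⟨⟩-⊕ (const 1)

─-⊕ : ∀ {U : Fin n → Bool} {u} → U u ≡ true → U ≐ (U ─ u) ⊕ u
─-⊕ {U = U} {u} Uu = Uu , removed , kept
  where
  removed : U u ∧ not (does (u ≟ u)) ≡ false
  removed rewrite dec-true (u ≟ u) refl = ∧-zeroʳ (U u)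
  kept : ∀ x → x ≢ u → U x ≡ U x ∧ not (does (x ≟ u))
  kept x x≢u rewrite dec-false (x ≟ u) x≢u = sym (∧-identityʳ (U x))

∪⁅⁆-⊕ : ∀ {U : Fin n → Bool} {u} → U u ≡ false → (U ∪⁅ u ⁆) ≐ U ⊕ u
∪⁅⁆-⊕ {U = U} {u} Uu = added , Uu , kept
  where
  added : U u ∨ does (u ≟ u) ≡ true
  added rewrite dec-true (u ≟ u) refl = ∨-zeroʳ (U u)
  kept : ∀ x → x ≢ u → U x ∨ does (x ≟ u) ≡ U x
  kept x x≢u rewrite dec-false (x ≟ u) x≢u = ∨-identityʳ (U x)

∖-⊕ : ∀ {S R : Fin n → Bool} {u} → S u ≡ true → R u ≡ false → (S ∖ R) ≐ (S ∖ (R ∪⁅ u ⁆)) ⊕ u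
∖-⊕ {S = S} {R} {u} Su Ru = outside , inside , kept
  where
  outside : S u ∧ not (R u) ≡ true
  outside rewrite Su | Ru = refl
  inside : S u ∧ not (R u ∨ does (u ≟ u)) ≡ false
  inside rewrite dec-true (u ≟ u) refl | ∨-zeroʳ (R u) = ∧-zeroʳ (S u)
  kept : ∀ x → x ≢ u → S x ∧ not (R x) ≡ S x ∧ not (R x ∨ does (x ≟ u))
  kept x x≢u rewrite dec-false (x ≟ u) x≢u | ∨-identityʳ (R x) = refl

⊕-⊇ : ∀ {U V : Fin n → Bool} {u x} → U ≐ V ⊕ u → V x ≡ true → U x ≡ true
⊕-⊇ {u = u} {x} (Uu , _ , U≗V) Vx with x ≟ u
... | yes refl = Uu
... | no x≢u   = trans (U≗V x x≢u) Vx

⊕-⊆ : ∀ {U V S : Fin n → Bool} {u} → U ≐ V ⊕ u → V ⊆ S → S u ≡ true → U ⊆ S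
⊕-⊆ {u = u} (_ , _ , U≗V) V⊆S Su x Ux with x ≟ u
... | yes refl = Su
... | no x≢u   = V⊆S x (trans (sym (U≗V x x≢u)) Ux)

⁅⁆-⊆ : ∀ {S : Fin n → Bool} {u} → S u ≡ true → ⁅ u ⁆ ⊆ S
⁅⁆-⊆ {u = u} Su x x∈⁅u⁆ with x ≟ u
⁅⁆-⊆ Su x refl | yes refl = Su

∑⟨⟩-member : ∀ {U : Fin n → Bool} {u} h → U u ≡ true → h u ≤ ∑⟨ U ⟩ h
∑⟨⟩-member {U = U} {u} h Uu = ≤-trans (m≤m+n (h u) _) (≤-reflexive (sym (∑⟨⟩-⊕ h (─-⊕ {U = U} Uu))))

empty-or-member : ∀ (U : Fin n → Bool) → (∀ x → U x ≡ false) ⊎ ∃ λ u → U u ≡ true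
empty-or-member U with any? (λ x → U x Bool.≟ true)
... | yes member = inj₂ member
... | no  empty  = inj₁ λ x → ¬-not λ Ux → empty (x , Ux)

∣∣≤1 : ∀ {n} {b : Fin n → Bool} → (∀ x y → b x ≡ true → b y ≡ true → x ≡ y) → ∣ b ∣ ≤ 1
∣∣≤1 {zero}      _   = z≤n
∣∣≤1 {suc n} {b} b-unique with b zero in b0
... | true  = ≤-reflexive (cong suc (∑⟨⟩-empty {n} {b ∘ suc} (const 1) rest-empty))
  where
  rest-empty : ∀ x → b (suc x) ≡ false
  rest-empty x = ¬-not λ bx → contradiction (b-unique zero (suc x) b0 bx) λ ()
... | false = ∣∣≤1 {n} {b ∘ suc} λ x y bx by → Fin.suc-injective (b-unique (suc x) (suc y) bx by)

length≤∣∣ : ∀ {b : Fin n → Bool} {xs} → Unique xs → All (λ x → b x ≡ true) xs → length xs ≤ ∣ b ∣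
length≤∣∣                  []            []         = z≤n
length≤∣∣ {b = b} {x ∷ xs} (x∉xs ∷ uniq) (bx ∷ bxs) = begin
  suc (length xs) ≤⟨ s≤s (length≤∣∣ uniq (All.zipWith still-in (x∉xs , bxs))) ⟩
  suc ∣ b ─ x ∣   ≡⟨ ∣∣-⊕ (─-⊕ {U = b} bx) ⟨
  ∣ b ∣           ∎
  where
  open ≤-Reasoning
  still-in : ∀ {y} → x ≢ y × b y ≡ true → (b ─ x) y ≡ true
  still-in {y} (x≢y , by) = trans (sym (proj₂ (proj₂ (─-⊕ {U = b} bx)) y (x≢y ∘ sym))) by

Unique⇒length≤ : ∀ {xs : List (Fin n)} → Unique xs → length xs ≤ n
Unique⇒length≤ {n} uniq = ≤-trans (length≤∣∣ {b = const true} uniq (All.universal (λ _ → refl) _))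
                                 (≤-reflexive (trans (∑-const n 1) (*-identityʳ n)))

length≤∑∣∣ : ∀ {m} {U : Fin m → Bool} {b : Fin m → Fin n → Bool} {ps} → Unique ps →
             All (λ p → U (proj₁ p) ≡ true × b (proj₁ p) (proj₂ p) ≡ true) ps →
             length ps ≤ ∑⟨ U ⟩ (λ x → ∣ b x ∣)
length≤∑∣∣ {n} {m} {U} {b} {ps} uniq Ub = begin
  length ps                                          ≡⟨ length-map (uncurry combine) ps ⟨
  length (map (uncurry combine) ps)                  ≤⟨ length≤∣∣ (Unique.map⁺ combine-inj uniq)
                                                                  (All.map⁺ (All.map encoded Ub)) ⟩
  ∣ code ∣                                           ≡⟨ ∑-combine m (𝟙 ∘ code) ⟩
  ∑ (λ (x : Fin m) → ∑ λ (y : Fin n) → 𝟙 (code (combine x y)))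
    ≡⟨ sum-cong-≗ (λ x → sum-cong-≗ (λ y → cong 𝟙 (decode x y))) ⟩
  ∑ (λ x → ∣ (λ y → U x ∧ b x y) ∣)                  ≡⟨ sum-cong-≗ rows ⟩
  ∑⟨ U ⟩ (λ x → ∣ b x ∣)                              ∎
  where
  open ≤-Reasoning
  code : Fin (m * n) → Bool
  code z = uncurry (λ x y → U x ∧ b x y) (remQuot n z)
  decode : ∀ x y → code (combine x y) ≡ U x ∧ b x y
  decode x y = cong (uncurry (λ x y → U x ∧ b x y)) (remQuot-combine x y)
  combine-inj : ∀ {p q : Fin m × Fin n} → uncurry combine p ≡ uncurry combine q → p ≡ q
  combine-inj {i , j} {k , l} eq with refl , refl ← combine-injective i j k l eq = refl
  encoded : ∀ {p} → U (proj₁ p) ≡ true × b (proj₁ p) (proj₂ p) ≡ true → code (uncurry combine p) ≡ true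
  encoded {x , y} (Ux , bxy) rewrite decode x y | Ux = bxy
  rows : ∀ x → ∣ (λ y → U x ∧ b x y) ∣ ≡ (if U x then ∣ b x ∣ else 0)
  rows x with U x
  ... | true  = refl
  ... | false = ∑⟨⟩-empty {n} {const false} (const 1) (λ _ → refl)

-- Simple graphs

module SimpleGraph {n : ℕ} (adj : Fin n → Fin n → Bool)
  (adj-sym : ∀ u v → adj u v ≡ adj v u) (adj-irrefl : ∀ v → adj v v ≡ false) where

  open Graph adj using (Adj; HasCycle)
  open import Data.List.Membership.DecPropositional (_≟_ {n}) using (_∈?_)

  Adj-sym : ∀ {u v} → Adj u v → Adj v u
  Adj-sym {u} {v} u~v = trans (adj-sym v u) u~v

  Adj-irrefl : ∀ {u v} → Adj u v → u ≢ v
  Adj-irrefl {u} u~u refl = contradiction (trans (sym u~u) (adj-irrefl u)) λ ()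

  full : Fin n → Bool
  full _ = true

  degIn : (Fin n → Bool) → Fin n → ℕ
  degIn V x = ∑⟨ V ⟩ (𝟙 ∘ adj x)

  -- counts ordered pairs, so every edge inside U is counted twice in arcs U U
  arcs : (Fin n → Bool) → (Fin n → Bool) → ℕ
  arcs U V = ∑⟨ U ⟩ degIn V

  arcs-∁ : ∀ U V → arcs U V + arcs U (∁ V) ≡ arcs U full
  arcs-∁ U V = trans (sym (∑⟨⟩-distrib-+ U (degIn V) (degIn (∁ V))))
                     (∑⟨⟩-congʳ U λ x → ∑⟨⟩-+-∁ V (𝟙 ∘ adj x))

  arcs-cong : ∀ {U V} → (∀ x → U x ≡ V x) → arcs U U ≡ arcs V V
  arcs-cong U≗V = ∑⟨⟩-cong U≗V λ x → ∑⟨⟩-cong U≗V λ _ → refl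

  degIn-⊕-self : ∀ {U V u} → U ≐ V ⊕ u → degIn U u ≡ degIn V u
  degIn-⊕-self {V = V} {u} U≐V⊕u =
    trans (∑⟨⟩-⊕ (𝟙 ∘ adj u) U≐V⊕u) (cong (λ b → 𝟙 b + degIn V u) (adj-irrefl u))

  arcs-⊕ : ∀ {U V u} → U ≐ V ⊕ u → arcs U U ≡ degIn V u + degIn V u + arcs V V
  arcs-⊕ {U} {V} {u} U≐V⊕u = begin
    arcs U U                                            ≡⟨ ∑⟨⟩-⊕ (degIn U) U≐V⊕u ⟩
    degIn U u + ∑⟨ V ⟩ degIn U
      ≡⟨ cong₂ _+_ (degIn-⊕-self U≐V⊕u) (∑⟨⟩-congʳ V λ x → ∑⟨⟩-⊕ (𝟙 ∘ adj x) U≐V⊕u) ⟩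
    degIn V u + ∑⟨ V ⟩ (λ x → 𝟙 (adj x u) + degIn V x)  ≡⟨ cong (degIn V u +_) (∑⟨⟩-distrib-+ V _ (degIn V)) ⟩
    degIn V u + (∑⟨ V ⟩ (λ x → 𝟙 (adj x u)) + arcs V V)
      ≡⟨ cong (λ t → degIn V u + (t + arcs V V)) (∑⟨⟩-congʳ V λ x → cong 𝟙 (adj-sym x u)) ⟩
    degIn V u + (degIn V u + arcs V V)                  ≡⟨ +-assoc (degIn V u) _ _ ⟨
    degIn V u + degIn V u + arcs V V                    ∎
    where open ≡-Reasoning

  EdgeLeaving : (R S : Fin n → Bool) → Set
  EdgeLeaving R S = ∃₂ λ x w → Adj x w × R x ≡ true × R w ≡ false × S w ≡ true

  ConnectedFrom : Fin n → (Fin n → Bool) → Set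
  ConnectedFrom r S = ∀ R → R r ≡ true → ∀ v → S v ≡ true → R v ≡ false → EdgeLeaving R S

  walk-leaves : ∀ {R S xs y z} → Linked Adj xs → All (λ v → S v ≡ true) xs →
                y ∈ xs → R y ≡ true → z ∈ xs → R z ≡ false → EdgeLeaving R S
  walk-leaves {xs = a ∷ []} _ _ (here refl) Ry (here refl) Rz = contradiction (trans (sym Ry) Rz) λ ()
  walk-leaves {R} {xs = a ∷ b ∷ _} (a~b ∷ walk) (Sa ∷ Sb ∷ Sxs) y∈ Ry z∈ Rz with R a in Ra | R b in Rb
  ... | true  | false = a , b , a~b , Ra , Rb , Sb
  ... | false | true  = b , a , Adj-sym a~b , Rb , Ra , Sa
  ... | true  | true  = walk-leaves walk (Sb ∷ Sxs) (here refl) Rb (∈-tail z≢a z∈) Rz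
    where z≢a = λ { refl → contradiction (trans (sym Ra) Rz) λ () }
  ... | false | false = walk-leaves walk (Sb ∷ Sxs) (∈-tail y≢a y∈) Ry (here refl) Rb
    where y≢a = λ { refl → contradiction (trans (sym Ry) Ra) λ () }

  module _ {S : Fin n → Bool} {r} (Sr : S r ≡ true) (connected : ConnectedFrom r S) where

    -- R grows from ⁅ r ⁆ along edges leaving it inside S; each added vertex brings at least
    -- one new edge, which keeps 2 * ∣ R ∣ ≤ arcs R R + 2.
    private
      grow : ∀ c R → ∣ S ∖ R ∣ ≡ c → R ⊆ S → R r ≡ true → 2 * ∣ R ∣ ≤ arcs R R + 2 →
             2 * ∣ S ∣ ≤ arcs S S + 2
      grow c R ∣S∖R∣≡c R⊆S Rr bound with empty-or-member (S ∖ R)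
      ... | inj₁ S∖R-empty = subst₂ (λ a b → 2 * a ≤ b + 2) (∑⟨⟩-cong R≗S λ _ → refl) (arcs-cong R≗S) bound
        where
        R≗S : ∀ x → R x ≡ S x
        R≗S x with R x in Rx | S x in Sx
        ... | true  | true  = refl
        ... | false | false = refl
        ... | true  | false = contradiction (trans (sym (R⊆S x Rx)) Sx) λ ()
        ... | false | true  = contradiction (trans (sym (S∖R-empty x)) (cong₂ (λ a b → a ∧ not b) Sx Rx)) λ ()
      ... | inj₂ (v , v∈S∖R)
        with x , w , x~w , Rx , Rw , Sw ← connected R Rr v (∧-conicalˡ (S v) _ v∈S∖R)
                                                  (Bool.not-injective (∧-conicalʳ (S v) _ v∈S∖R))
        with c | trans (sym ∣S∖R∣≡c) (∣∣-⊕ (∖-⊕ {S = S} {R} Sw Rw))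
      ... | zero   | ()
      ... | suc c′ | c≡ =
        grow c′ (R ∪⁅ w ⁆) (sym (suc-injective c≡)) (⊕-⊆ R′≐R⊕w R⊆S Sw) (⊕-⊇ R′≐R⊕w Rr) bound′
        where
        R′≐R⊕w : (R ∪⁅ w ⁆) ≐ R ⊕ w
        R′≐R⊕w = ∪⁅⁆-⊕ Rw
        d = degIn R w
        1≤d : 1 ≤ d
        1≤d = subst (λ b → 𝟙 b ≤ d) (Adj-sym x~w) (∑⟨⟩-member {U = R} (𝟙 ∘ adj w) Rx)
        bound′ : 2 * ∣ R ∪⁅ w ⁆ ∣ ≤ arcs (R ∪⁅ w ⁆) (R ∪⁅ w ⁆) + 2
        bound′ = begin
          2 * ∣ R ∪⁅ w ⁆ ∣                   ≡⟨ cong (2 *_) (∣∣-⊕ R′≐R⊕w) ⟩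
          2 * suc ∣ R ∣                      ≡⟨ *-suc 2 ∣ R ∣ ⟩
          2 + 2 * ∣ R ∣                      ≤⟨ +-monoʳ-≤ 2 bound ⟩
          2 + (arcs R R + 2)                 ≤⟨ +-monoˡ-≤ _ (+-mono-≤ 1≤d 1≤d) ⟩
          d + d + (arcs R R + 2)             ≡⟨ +-assoc (d + d) _ 2 ⟨
          d + d + arcs R R + 2               ≡⟨ cong (_+ 2) (arcs-⊕ R′≐R⊕w) ⟨
          arcs (R ∪⁅ w ⁆) (R ∪⁅ w ⁆) + 2     ∎
          where open ≤-Reasoning

    connected⇒2∣S∣≤arcs+2 : 2 * ∣ S ∣ ≤ arcs S S + 2
    connected⇒2∣S∣≤arcs+2 = grow _ ⁅ r ⁆ refl (⁅⁆-⊆ Sr) (dec-true (r ≟ r) refl) base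
      where
      base : 2 * ∣ ⁅ r ⁆ ∣ ≤ arcs ⁅ r ⁆ ⁅ r ⁆ + 2
      base rewrite ∑⟨⁅⁆⟩ r (const 1) = m≤n+m 2 _

  Path : (Fin n → Bool) → List (Fin n) → Set
  Path U ps = Linked Adj ps × Unique ps × All (λ x → U x ≡ true) ps

  private
    prefix-to : ∀ {y zs w x} → Linked Adj (y ∷ zs) → Unique (y ∷ zs) → w ∈ zs → Adj w x →
                ∃ λ pre → Linked Adj (y ∷ pre ++ x ∷ []) × Unique (y ∷ pre) × pre ⊆ᴸ zs × 1 ≤ length pre
    prefix-to {zs = z ∷ zs} (y~z ∷ _) (y∉ ∷ _) (here refl) w~x =
      z ∷ [] , y~z ∷ w~x ∷ [-] , All.anti-mono head⊆ y∉ ∷ [] ∷ [] , head⊆ , s≤s z≤n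
      where
      head⊆ : z ∷ [] ⊆ᴸ z ∷ zs
      head⊆ (here refl) = here refl
    prefix-to {zs = z ∷ zs} (y~z ∷ walk) (y∉ ∷ uniq) (there w∈) w~x
      with pre , walk′ , uniq′ , pre⊆ , _ ← prefix-to walk uniq w∈ w~x =
      z ∷ pre , y~z ∷ walk′ , All.anti-mono z∷pre⊆ y∉ ∷ uniq′ , z∷pre⊆ , s≤s z≤n
      where
      z∷pre⊆ : z ∷ pre ⊆ᴸ z ∷ zs
      z∷pre⊆ (here refl) = here refl
      z∷pre⊆ (there t∈)  = there (pre⊆ t∈)

  chord⇒cycle : ∀ {x y zs w} → Linked Adj (x ∷ y ∷ zs) → Unique (x ∷ y ∷ zs) → w ∈ zs → Adj x w →
                HasCycle
  chord⇒cycle {x} {y} {zs} (x~y ∷ walk) (x∉ ∷ uniq) w∈ x~w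
    with pre , walk′ , uniq′ , pre⊆ , 1≤∣pre∣ ← prefix-to walk uniq w∈ (Adj-sym x~w) =
    x , y ∷ pre , s≤s 1≤∣pre∣ , All.anti-mono y∷pre⊆ x∉ ∷ uniq′ , x~y ∷ walk′
    where
    y∷pre⊆ : y ∷ pre ⊆ᴸ y ∷ zs
    y∷pre⊆ (here refl) = here refl
    y∷pre⊆ (there t∈)  = there (pre⊆ t∈)

  module _ (acyclic : ¬ HasCycle) where

    private
      neighbour-on-path : ∀ {e rest w} → Linked Adj (e ∷ rest) → Unique (e ∷ rest) →
                          Adj e w → w ∈ e ∷ rest → head rest ≡ just w
      neighbour-on-path _ _ e~w (here refl) = contradiction refl (Adj-irrefl e~w)
      neighbour-on-path {rest = _ ∷ _} _ _ _ (there (here refl)) = refl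
      neighbour-on-path {rest = _ ∷ _} walk uniq e~w (there (there w∈)) =
        contradiction (chord⇒cycle walk uniq w∈ e~w) acyclic

      extend-or-low-degree : ∀ {U e rest} → Path U (e ∷ rest) →
                             (∃ λ w → Path U (w ∷ e ∷ rest)) ⊎ degIn U e ≤ 1
      extend-or-low-degree {U} {e} {rest} (walk , uniq , inU)
        with any? (λ w → ((U w ∧ adj e w) Bool.≟ true) ×-dec ¬? (w ∈? e ∷ rest))
      ... | yes (w , Uw∧e~w , w∉) =
        inj₁ (w , Adj-sym (∧-conicalʳ (U w) _ Uw∧e~w) ∷ walk ,
                  All.¬Any⇒All¬ (e ∷ rest) w∉ ∷ uniq , ∧-conicalˡ (U w) _ Uw∧e~w ∷ inU)
      ... | no none = inj₂ (≤-trans (≤-reflexive (∑⟨⟩-𝟙 U (adj e))) (∣∣≤1 at-most-one))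
        where
        on-path : ∀ {y} → U y ∧ adj e y ≡ true → head rest ≡ just y
        on-path {y} y∼ = neighbour-on-path walk uniq (∧-conicalʳ (U y) _ y∼)
                           (decidable-stable (y ∈? e ∷ rest) λ y∉ → none (y , y∼ , y∉))
        at-most-one : ∀ y y′ → U y ∧ adj e y ≡ true → U y′ ∧ adj e y′ ≡ true → y ≡ y′
        at-most-one _ _ y∼ y′∼ = just-injective (trans (sym (on-path y∼)) (on-path y′∼))

    -- extend a path inside U until its endpoint has no neighbour in U off the path;
    -- by acyclicity that endpoint then has at most one neighbour in U
    low-degree-vertex : ∀ {U u} → U u ≡ true → ∃ λ v → U v ≡ true × degIn U v ≤ 1
    low-degree-vertex {U} {u} Uu = go n ([-] , [] ∷ [] , Uu ∷ []) ≤-refl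
      where
      go : ∀ fuel {e rest} → Path U (e ∷ rest) → n < length (e ∷ rest) + fuel →
           ∃ λ v → U v ≡ true × degIn U v ≤ 1
      go zero       (_ , uniq , _) n<∣ps∣ =
        contradiction (Unique⇒length≤ uniq) (<⇒≱ (subst (n <_) (+-identityʳ _) n<∣ps∣))
      go (suc fuel) {e} path n<∣ps∣ with extend-or-low-degree path
      ... | inj₁ (_ , longer) = go fuel longer (subst (n <_) (+-suc _ fuel) n<∣ps∣)
      ... | inj₂ low          = e , All.head (proj₂ (proj₂ path)) , low

    acyclic⇒arcs+2≤2∣U∣ : ∀ {U u} → U u ≡ true → arcs U U + 2 ≤ 2 * ∣ U ∣
    acyclic⇒arcs+2≤2∣U∣ Uu = go _ refl Uu
      where
      go : ∀ c {U u} → ∣ U ∣ ≡ c → U u ≡ true → arcs U U + 2 ≤ 2 * ∣ U ∣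
      remove : ∀ c {U V v} → ∣ U ∣ ≡ c → U ≐ V ⊕ v → degIn V v ≤ 1 → arcs U U + 2 ≤ 2 * ∣ U ∣

      go c {U} ∣U∣≡c Uu with v , Uv , low ← low-degree-vertex Uu =
        remove c ∣U∣≡c (─-⊕ Uv) (subst (_≤ 1) (degIn-⊕-self (─-⊕ {U = U} Uv)) low)

      remove zero    ∣U∣≡0 U≐V⊕v _ = contradiction (trans (sym (∣∣-⊕ U≐V⊕v)) ∣U∣≡0) λ ()
      remove (suc c) {U} {V} {v} ∣U∣≡c U≐V⊕v d≤1 with empty-or-member V
      ... | inj₂ (w , Vw) = begin
        arcs U U + 2                            ≡⟨ cong (_+ 2) (arcs-⊕ U≐V⊕v) ⟩
        degIn V v + degIn V v + arcs V V + 2    ≡⟨ +-assoc (degIn V v + degIn V v) (arcs V V) 2 ⟩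
        degIn V v + degIn V v + (arcs V V + 2)  ≤⟨ +-mono-≤ (+-mono-≤ d≤1 d≤1) (go c ∣V∣≡c Vw) ⟩
        2 + 2 * ∣ V ∣                           ≡⟨ *-suc 2 ∣ V ∣ ⟨
        2 * suc ∣ V ∣                           ≡⟨ cong (2 *_) (∣∣-⊕ U≐V⊕v) ⟨
        2 * ∣ U ∣                               ∎
        where
        open ≤-Reasoning
        ∣V∣≡c : ∣ V ∣ ≡ c
        ∣V∣≡c = suc-injective (trans (sym (∣∣-⊕ U≐V⊕v)) ∣U∣≡c)
      ... | inj₁ V-empty = ≤-reflexive (begin
        arcs U U + 2                            ≡⟨ cong (_+ 2) (arcs-⊕ U≐V⊕v) ⟩
        degIn V v + degIn V v + arcs V V + 2
          ≡⟨ cong₂ (λ d a → d + d + a + 2) (∑⟨⟩-empty _ V-empty) (∑⟨⟩-empty _ V-empty) ⟩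
        2                                       ≡⟨ cong (λ s → 2 * suc s) (∑⟨⟩-empty _ V-empty) ⟨
        2 * suc ∣ V ∣                           ≡⟨ cong (2 *_) (∣∣-⊕ U≐V⊕v) ⟨
        2 * ∣ U ∣                               ∎)
        where open ≡-Reasoning

-- Spans in a phylogenetic tree

module Tree {m} (T : UTree m) where
  open UTree T hiding (n)
  open SimpleGraph adj adj-sym adj-irrefl public

  deg≡degIn : ∀ v → deg v ≡ degIn full v
  deg≡degIn v = trans (cong sum (map-tabulate id (𝟙 ∘ adj v))) (sum-tabulate (𝟙 ∘ adj v))

  module Span {B : Fin m → Set} (B? : ∀ v → Dec (InSpan T B v)) where

    span : Fin (UTree.n T) → Bool
    span v = does (B? v)

    span-complete : ∀ {v} → InSpan T B v → span v ≡ true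
    span-complete {v} = dec-true (B? v)

    span-sound : ∀ {v} → span v ≡ true → InSpan T B v
    span-sound {v} with B? v
    ... | yes v∈ = λ _ → v∈

    leaf∈span : ∀ {x} → B x → span (leaf x) ≡ true
    leaf∈span {x} Bx =
      span-complete (x , x , Bx , Bx , leaf x ∷ [] , ([-] , [] ∷ [] , refl , refl) , here refl)

    path⊆span : ∀ {a b ps} → B a → B b → IsPath (leaf a) (leaf b) ps → All (λ w → span w ≡ true) ps
    path⊆span Ba Bb path = All.tabulate λ w∈ → span-complete (_ , _ , Ba , Bb , _ , path , w∈)

    span-connected : ∀ {x₀} → B x₀ → ConnectedFrom (leaf x₀) span
    span-connected {x₀} Bx₀ R Rx₀ v v∈span Rv
      with a , b , Ba , Bb , ps , ps-path@(walk , _ , ps-head , _) , v∈ps ← span-sound v∈span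
      with R (leaf a) in Ra
    ... | true  = walk-leaves walk (path⊆span Ba Bb ps-path) (head∈ ps-head) Ra v∈ps Rv
    ... | false with qs , qs-path@(walk′ , _ , qs-head , qs-last) ← connected (leaf x₀) (leaf a) =
      walk-leaves walk′ (path⊆span Bx₀ Ba qs-path) (head∈ qs-head) Rx₀ (last∈ qs-last) Ra

    DegIs⇒≤arcs : ∀ {d} → DegIs T B d → d ≤ arcs span (∁ span)
    DegIs⇒≤arcs (ps , uniq , ps⇔ , refl) = begin
      length ps
        ≤⟨ length≤∑∣∣ {U = span} {b = λ x y → ∁ span y ∧ adj x y} uniq
             (All.tabulate λ {p} p∈ → leaving (Equivalence.to (ps⇔ p) p∈)) ⟩
      ∑⟨ span ⟩ (λ x → ∣ (λ y → ∁ span y ∧ adj x y) ∣) ≡⟨ ∑⟨⟩-congʳ span (λ x → ∑⟨⟩-𝟙 (∁ span) (adj x)) ⟨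
      arcs span (∁ span)                                ∎
      where
      open ≤-Reasoning
      leaving : ∀ {p} → Adj (proj₁ p) (proj₂ p) × InSpan T B (proj₁ p) × ¬ InSpan T B (proj₂ p) →
                span (proj₁ p) ≡ true × ∁ span (proj₂ p) ∧ adj (proj₁ p) (proj₂ p) ≡ true
      leaving {x , y} (x~y , x∈ , y∉) rewrite dec-false (B? y) y∉ = span-complete x∈ , x~y

-- Agreement forests

module Blocks {m k} (T : UTree m) (blk : Fin m → Fin k) (blk-onto : Surjective blk)
  (disjoint : ∀ j j′ → j ≢ j′ → ∀ v → ¬ (InSpan T (Block blk j) v × InSpan T (Block blk j′) v))
  (B? : ∀ j v → Dec (InSpan T (Block blk j) v)) where

  open UTree T using (leaf; binary; leaf-onto; acyclic)
  open Tree T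

  S : Fin k → Fin (UTree.n T) → Bool
  S j = Span.span (B? j)

  cover : Fin (UTree.n T) → ℕ
  cover x = ∣ (λ j → S j x) ∣

  free : Fin (UTree.n T) → Bool
  free x = cover x ≡ᵇ 0

  cover≤1 : ∀ x → cover x ≤ 1
  cover≤1 x = ∣∣≤1 λ j j′ x∈j x∈j′ → decidable-stable (j ≟ j′) λ j≢j′ →
    disjoint j j′ j≢j′ x (Span.span-sound (B? j) x∈j , Span.span-sound (B? j′) x∈j′)

  cover+free≡1 : ∀ x → cover x + 𝟙 (free x) ≡ 1
  cover+free≡1 x with cover x | cover≤1 x
  ... | 0           | _      = refl
  ... | 1           | _      = refl
  ... | suc (suc _) | s≤s ()

  leaf-covered : ∀ y → (cover (leaf y) ≡ᵇ 0) ≡ false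
  leaf-covered y
    with cover (leaf y) | ∑⟨⟩-member {U = λ j → S j (leaf y)} (const 1) (Span.leaf∈span (B? (blk y)) refl)
  ... | suc _ | _ = refl

  free⇒2≤degree : ∀ x → free x ≡ true → 2 ≤ degIn full x
  free⇒2≤degree x free-x with binary x
  ... | inj₂ deg≡3 = ≤-trans (m≤n+m 2 1) (≤-reflexive (trans (sym deg≡3) (deg≡degIn x)))
  ... | inj₁ deg≤1 with y , refl ← leaf-onto x deg≤1 =
    contradiction (trans (sym free-x) (leaf-covered y)) λ ()

  module _ (d : Fin k → ℕ) (degIs : ∀ j → DegIs T (Block blk j) (d j)) (x₀ : Fin m) where

    private
      inArcs outArcs freeDeg : ℕ
      inArcs  = ∑ λ j → arcs (S j) (S j)
      outArcs = ∑ λ j → arcs (S j) (∁ (S j))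
      freeDeg = ∑⟨ free ⟩ degIn full

      vertex-count : ∣ full ∣ ≡ ∑ (λ j → ∣ S j ∣) + ∣ free ∣
      vertex-count = ∑-partition S free cover+free≡1 (const 1)

      degree-sum : arcs full full ≡ inArcs + outArcs + freeDeg
      degree-sum = begin
        arcs full full                                ≡⟨ ∑-partition S free cover+free≡1 (degIn full) ⟩
        ∑ (λ j → arcs (S j) full) + freeDeg
          ≡⟨ cong (_+ freeDeg) (sum-cong-≗ λ j → arcs-∁ (S j) (S j)) ⟨
        ∑ (λ j → arcs (S j) (S j) + arcs (S j) (∁ (S j))) + freeDeg
          ≡⟨ cong (_+ freeDeg) (∑-distrib-+ (λ j → arcs (S j) (S j)) _) ⟩
        inArcs + outArcs + freeDeg                    ∎
        where open ≡-Reasoning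

      spans-bound : 2 * ∑ (λ j → ∣ S j ∣) ≤ inArcs + 2 * k
      spans-bound = begin
        2 * ∑ (λ j → ∣ S j ∣)           ≡⟨ *-distribˡ-sum 2 (λ j → ∣ S j ∣) ⟩
        ∑ (λ j → 2 * ∣ S j ∣)           ≤⟨ ∑-mono-≤ span-bound ⟩
        ∑ (λ j → arcs (S j) (S j) + 2)  ≡⟨ ∑-distrib-+ (λ j → arcs (S j) (S j)) (const 2) ⟩
        inArcs + ∑ {k} (const 2)        ≡⟨ cong (inArcs +_) (trans (∑-const k 2) (*-comm k 2)) ⟩
        inArcs + 2 * k                  ∎
        where
        open ≤-Reasoning
        span-bound : ∀ j → 2 * ∣ S j ∣ ≤ arcs (S j) (S j) + 2
        span-bound j with x , blk-x≡j ← blk-onto j =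
          connected⇒2∣S∣≤arcs+2 (Span.leaf∈span (B? j) blk-x≡j) (Span.span-connected (B? j) blk-x≡j)

      free-bound : 2 * ∣ free ∣ ≤ freeDeg
      free-bound = begin
        2 * ∣ free ∣         ≡⟨ cong (∣ free ∣ +_) (+-identityʳ ∣ free ∣) ⟩
        ∣ free ∣ + ∣ free ∣  ≡⟨ ∑⟨⟩-distrib-+ free (const 1) (const 1) ⟨
        ∑⟨ free ⟩ const 2    ≤⟨ ∑⟨⟩-mono-≤ free free⇒2≤degree ⟩
        freeDeg              ∎
        where open ≤-Reasoning

    ∑deg+2≤2k : ∑ d + 2 ≤ 2 * k
    ∑deg+2≤2k = +-cancelˡ-≤ (inArcs + freeDeg) (∑ d + 2) (2 * k) (begin
      inArcs + freeDeg + (∑ d + 2)             ≤⟨ +-monoʳ-≤ (inArcs + freeDeg) (+-monoˡ-≤ 2 ∑d≤outArcs) ⟩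
      inArcs + freeDeg + (outArcs + 2)         ≡⟨ shuffle inArcs outArcs freeDeg ⟩
      inArcs + outArcs + freeDeg + 2           ≡⟨ cong (_+ 2) degree-sum ⟨
      arcs full full + 2                       ≤⟨ acyclic⇒arcs+2≤2∣U∣ acyclic {u = leaf x₀} refl ⟩
      2 * ∣ full ∣                             ≡⟨ cong (2 *_) vertex-count ⟩
      2 * (∑ (λ j → ∣ S j ∣) + ∣ free ∣)       ≡⟨ *-distribˡ-+ 2 (∑ (λ j → ∣ S j ∣)) ∣ free ∣ ⟩
      2 * ∑ (λ j → ∣ S j ∣) + 2 * ∣ free ∣     ≤⟨ +-mono-≤ spans-bound free-bound ⟩
      inArcs + 2 * k + freeDeg                 ≡⟨ shuffle′ inArcs (2 * k) freeDeg ⟩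
      inArcs + freeDeg + 2 * k                 ∎)
      where
      open ≤-Reasoning
      ∑d≤outArcs : ∑ d ≤ outArcs
      ∑d≤outArcs = ∑-mono-≤ λ j → Span.DegIs⇒≤arcs (B? j) (degIs j)
      shuffle : ∀ a b c → a + c + (b + 2) ≡ a + b + c + 2
      shuffle = solve-∀
      shuffle′ : ∀ a b c → a + b + c ≡ a + c + b
      shuffle′ = solve-∀

¬¬-∀Fin : ∀ {k} {P : Fin k → Set} → (∀ i → ¬ ¬ P i) → ¬ ¬ (∀ i → P i)
¬¬-∀Fin {zero}  _   ¬∀P = ¬∀P λ ()
¬¬-∀Fin {suc k} ¬¬P ¬∀P = ¬¬P zero λ P₀ → ¬¬-∀Fin (¬¬P ∘ suc) λ P₊ → ¬∀P λ { zero → P₀ ; (suc i) → P₊ i }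

lemma4 : {m k : ℕ} (𝒯 : List (UTree m)) (blk : Fin m → Fin k) →
         IsAgreementForest 𝒯 blk →
         ∀ T → T ∈ 𝒯 →
         (d : Fin k → ℕ) → (∀ j → DegIs T (Block blk j) (d j)) →
         sum (tabulate d) ≤ 2 * k ∸ 2
lemma4 {k = zero}  _ _ _ _ _ _ _ = z≤n
lemma4 {k = suc k} 𝒯 blk (blk-onto , _ , disjoint) T T∈𝒯 d degIs =
  -- membership in a span need not be decidable, but the goal is, so we may assume it under ¬¬
  decidable-stable (sum (tabulate d) ≤? 2 * suc k ∸ 2) λ ¬bound →
    ¬¬-∀Fin (λ j → ¬¬-∀Fin λ v → ¬¬-excluded-middle) λ B? →
      ¬bound (subst (_≤ 2 * suc k ∸ 2) (sym (sum-tabulate d))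
               (m+n≤o⇒m≤o∸n (∑ d) (Blocks.∑deg+2≤2k T blk blk-onto (disjoint T T∈𝒯) B? d degIs x₀)))
  where
  x₀ = proj₁ (blk-onto zero)
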